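{- Let $f_1 f_2 \cdots f_z$ be the LZ-End parsing of a string. Then, for any $i \in [1..z)$, no proper prefix of length at least $|f_i|$ of the string $f_i f_{i+1}\cdots f_z$ is a suffix of a string $f_1 f_2 \cdots f_j$ with $j < i$.
   Context: For a string $s$, $s[i..j] = s[i]s[i+1]\cdots s[j]$, and $[i..j) = \{k \in \mathbb{Z} : i \le k < j\}$. The LZ-End parsing of $s$ is the decomposition $s = f_1 f_2 \cdots f_z$ built greedily from left to right: if a prefix $s[1..k] = f_1 f_2\cdots f_{i-1}$ has already been parsed, then $f_i[1..|f_i|-1]$ is the longest prefix of $s[k+1..|s|-1]$ that is a suffix of some string $f_1 f_2 \cdots f_j$ with $j < i$ (the empty string counts as such a suffix), and $f_i$ is this prefix extended by the next letter of $s$. The substrings $f_i$ are called phrases. -}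

module Defs where

open import Data.List using (List; []; _∷_; _++_; length; concat; take; [_])
open import Data.Nat using (ℕ; _≤_; _<_)
open import Data.Product using (Σ; ∃; _×_)
open import Relation.Binary.PropositionalEquality using (_≡_)

module _ {A : Set} where

  _IsPrefixOf_ : List A → List A → Set
  p IsPrefixOf s = ∃ λ t → p ++ t ≡ s

  _IsSuffixOf_ : List A → List A → Set
  p IsSuffixOf s = ∃ λ t → t ++ p ≡ s

  -- With pre = [f_1, ..., f_{i-1}]: q is a suffix of f_1 f_2 ... f_j for some j < i
  -- (j = 0 gives the empty string, which therefore always counts).
  SuffixOfEarlier : List (List A) → List A → Set
  SuffixOfEarlier pre q = ∃ λ j → j ≤ length pre × q IsSuffixOf concat (take j pre)

  -- The LZ-End condition on phrase f = f_i, where pre = [f_1, ..., f_{i-1}]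
  -- and rest = f_i f_{i+1} ... f_z = s[k+1..|s|] (with k = |f_1 ... f_{i-1}|).
  record LZEndPhrase (pre : List (List A)) (f : List A) (rest : List A) : Set where
    field
      body : List A
      lastLetter : A
      shape : f ≡ body ++ [ lastLetter ]
      extends : (body ++ [ lastLetter ]) IsPrefixOf rest
      bodyEarlier : SuffixOfEarlier pre body
      -- body is the longest prefix of s[k+1..|s|-1] that is a suffix of some f_1...f_j, j < i
      longest : ∀ q → q IsPrefixOf rest → length q < length rest →
                SuffixOfEarlier pre q → length q ≤ length body

  IsLZEndParsing : List A → List (List A) → Set
  IsLZEndParsing s fs =
    concat fs ≡ s ×
    (∀ pre f post → fs ≡ pre ++ (f ∷ post) → LZEndPhrase pre f (concat (f ∷ post)))

-- The body of an LZ-End phrase f_i is by definition the longest prefix of f_i f_(i+1) ... f_z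
-- that is a suffix of some f_1 ... f_j with j < i, and f_i is one letter longer than its body;
-- so every such prefix is strictly shorter than f_i.
module Submission where

open import Defs
open import Data.List using (List; []; _∷_; _++_; length; concat; [_])
open import Data.List.Properties using (length-++)
open import Data.Nat using (suc; _≤_; _<_; _+_; s≤s)
open import Data.Nat.Properties using (+-comm; <⇒≱)
open import Data.Product using (_,_)
open import Relation.Binary.PropositionalEquality using (_≡_; _≢_; cong; sym; subst; module ≡-Reasoning)
open import Relation.Nullary using (¬_)

module _ {A : Set} {pre : List (List A)} {f rest : List A} (phrase : LZEndPhrase pre f rest) where
  open LZEndPhrase phrase

  length-phrase : length f ≡ suc (length body)
  length-phrase = begin
    length f                          ≡⟨ cong length shape ⟩
    length (body ++ [ lastLetter ])   ≡⟨ length-++ body ⟩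
    length body + 1                   ≡⟨ +-comm (length body) 1 ⟩
    suc (length body)                 ∎
    where open ≡-Reasoning

  earlier-prefix-shorter-than-phrase : ∀ q → q IsPrefixOf rest → length q < length rest →
                                       SuffixOfEarlier pre q → length q < length f
  earlier-prefix-shorter-than-phrase q q⊑rest q<rest q-earlier =
    subst (length q <_) (sym length-phrase) (s≤s (longest q q⊑rest q<rest q-earlier))

lemma1 : {A : Set} (s : List A) (fs : List (List A)) → IsLZEndParsing s fs →
    ∀ pre f post → fs ≡ pre ++ (f ∷ post) → post ≢ [] →
    ∀ (q : List A) → q IsPrefixOf concat (f ∷ post) →
    length q < length (concat (f ∷ post)) → length f ≤ length q →
    ¬ SuffixOfEarlier pre q
lemma1 s fs (_ , phrases) pre f post fs≡ _ q q⊑rest q<rest f≤q q-earlier =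
  <⇒≱ (earlier-prefix-shorter-than-phrase (phrases pre f post fs≡) q q⊑rest q<rest q-earlier) f≤q
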